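{- Let $S$ be a string, $\sigma$ a character, $k,r$ positive integers, and let $\ell$ be the number of occurrences of $\sigma$ in $S$, with $R=\ell-rk\ge 0$. Then the number of distinct $\sigma$-starts for $\sigma^r$ (with respect to $k$) is at most $\binom{R+k}{k}$.
   Context: For a string $S$ and indices $i\le j$, $S[i,j]=S[i]\cdots S[j]$. Given $S$, $k$ and $r$, a $\sigma$-start for $\sigma^r$ is a $k$-tuple $(p_1,\dots,p_k)$ of integers such that (1) $1\le p_1<p_2<\dots<p_k\le |S|$; (2) $S[p_1]=\dots=S[p_k]=\sigma$; (3) setting $p_{k+1}=|S|+1$, the string $\sigma^r$ ($r$ copies of $\sigma$) is a subsequence of $S[p_j,p_{j+1}-1]$ for every $j=1,\dots,k$. -}

module Defs where

open import Data.Nat using (ℕ; zero; suc; _+_; _∸_; _<_; _≤_)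
open import Data.List using (List; []; _∷_; length; drop; take; replicate; filter)
open import Data.List.Relation.Binary.Sublist.Propositional using (_⊆_)
open import Data.Vec using (Vec; lookup; _∷ʳ_)
open import Data.Fin using (Fin; inject₁; suc)
open import Data.Maybe using (Maybe; just; nothing)
open import Relation.Binary.PropositionalEquality using (_≡_)

-- S[i] with 1-based indexing (nothing when out of range / i = 0)
charAt : {A : Set} → List A → ℕ → Maybe A
charAt S zero = nothing
charAt [] (suc i) = nothing
charAt (x ∷ S) (suc zero) = just x
charAt (x ∷ S) (suc (suc i)) = charAt S (suc i)

-- S[i, j-1] with 1-based indexing, i.e. the characters at positions i .. j-1
segment : {A : Set} → List A → ℕ → ℕ → List A
segment S i j = take (j ∸ i) (drop (i ∸ 1) S)

extend : {A : Set} {k : ℕ} → List A → Vec ℕ k → Vec ℕ (suc k)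
extend S ps = ps ∷ʳ suc (length S)

record IsSigmaStart {A : Set} (S : List A) (σ : A) (k r : ℕ) (ps : Vec ℕ k) : Set where
  field
    positive   : ∀ (j : Fin k) → 1 ≤ lookup ps j
    increasing : ∀ (j : Fin k) → lookup (extend S ps) (inject₁ j) < lookup (extend S ps) (suc j)
    isSigma    : ∀ (j : Fin k) → charAt S (lookup ps j) ≡ just σ
    hasPower   : ∀ (j : Fin k) →
      replicate r σ ⊆ segment S (lookup (extend S ps) (inject₁ j)) (lookup (extend S ps) (suc j))

{-# OPTIONS --safe #-}
module Submission where

open import Defs
open import Data.Nat using (ℕ; _+_; _*_; _∸_; _≤_)
open import Data.Nat.Combinatorics using (_C_)
open import Data.List using (List; length; filter)
open import Data.List.Relation.Unary.All using (All)
open import Data.List.Relation.Unary.Unique.Propositional using (Unique)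
open import Data.Vec using (Vec)
open import Relation.Binary.Definitions using (DecidableEquality)

open import Level using (0ℓ)
open import Function using (_∘_)
open import Data.Nat using (zero; suc; pred; _<_; z≤n; s≤s; s≤s⁻¹)
open import Data.Nat.Properties
  using ( ≤-refl; ≤-trans; ≤-reflexive; m≤n⇒m≤1+n; ≤⇒≯; +-mono-≤; +-suc; +-identityʳ; *-comm
        ; m+[n∸m]≡n; module ≤-Reasoning)
open import Data.Nat.Combinatorics using (nCk+nC[k+1]≡[n+1]C[k+1])
open import Data.List using ([]; _∷_; map; replicate)
open import Data.List.Properties using (length-map; length-replicate; take-all; filter-all)
open import Data.List.Relation.Unary.All using ([]; _∷_)
import Data.List.Relation.Unary.All as All
open import Data.List.Relation.Unary.All.Properties using (replicate⁺)
open import Data.List.Relation.Unary.AllPairs using (AllPairs; []; _∷_)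
open import Data.List.Relation.Unary.Unique.Propositional.Properties using (map⁻)
open import Data.List.Relation.Binary.Sublist.Propositional using (_⊆_; []; _∷_; _∷ʳ_; minimum)
open import Data.List.Relation.Binary.Sublist.Propositional.Properties using (All-resp-⊆)
open import Data.List.Relation.Binary.Sublist.Heterogeneous.Properties
  using (∷⁻; ∷ʳ⁻; length-mono-≤; ⊆-filter-Sublist)
open import Data.Vec using ([]; _∷_; lookup) renaming (map to vmap)
open import Data.Fin using () renaming (zero to fzero; suc to fsuc)
open import Data.Maybe using (just)
open import Data.Product using (_×_; _,_; proj₂; ∃-syntax; ∃₂)
open import Data.Sum using (_⊎_; inj₁; inj₂)
open import Relation.Binary.Core using (Rel)
open import Relation.Binary.PropositionalEquality using (_≡_; _≢_; refl; sym; trans; cong; subst)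
open import Relation.Nullary using (yes; no; contradiction; Irrelevant)
open import Relation.Unary using (Pred; Empty; _∪_)
import Relation.Unary as Pred

-- Follow the first character x of S. A tuple of σ-starts either begins at position 1, and then x = σ
-- is the first σ of the first block and the other starts form a tuple in the tail that must first
-- see r - 1 further σ's, or it lies entirely in the tail. So generalise to tuples preceded by c owed
-- σ's: by induction on S, if S has at most c + kr + R σ's there are at most C(R + k, k) of them. The
-- two alternatives contribute C(R + k - 1, k - 1) and C(R + k - 1, k), which add up by Pascal's rule;
-- when R = 0 the second is empty, since every such tuple uses c + kr σ's of S.

module _ {X : Set} where

  AtMost : ℕ → Pred X 0ℓ → Set
  AtMost n Q = ∀ xs → Unique xs → All Q xs → length xs ≤ n

  AtMost-mono : ∀ {m n} {Q : Pred X 0ℓ} → m ≤ n → AtMost m Q → AtMost n Q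
  AtMost-mono m≤n atMost xs u qs = ≤-trans (atMost xs u qs) m≤n

  AtMost-⊆ : ∀ {n} {P Q : Pred X 0ℓ} → P Pred.⊆ Q → AtMost n Q → AtMost n P
  AtMost-⊆ P⊆Q atMost xs u ps = atMost xs u (All.map P⊆Q ps)

  AtMost-empty : ∀ {n} {Q : Pred X 0ℓ} → Empty Q → AtMost n Q
  AtMost-empty _ [] _ _ = z≤n
  AtMost-empty ∅ (x ∷ _) _ (q ∷ _) = contradiction q (∅ x)

  AtMost-irrelevant : ∀ {Q : Pred X 0ℓ} → Irrelevant X → AtMost 1 Q
  AtMost-irrelevant _ [] _ _ = z≤n
  AtMost-irrelevant _ (_ ∷ []) _ _ = ≤-refl
  AtMost-irrelevant irr (x ∷ y ∷ _) ((x≢y ∷ _) ∷ _) _ = contradiction (irr x y) x≢y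

  AllPairs-resp-⊆ : ∀ {R : Rel X 0ℓ} {xs ys} → ys ⊆ xs → AllPairs R xs → AllPairs R ys
  AllPairs-resp-⊆ [] [] = []
  AllPairs-resp-⊆ (_ ∷ʳ τ) (_ ∷ rs) = AllPairs-resp-⊆ τ rs
  AllPairs-resp-⊆ (refl ∷ τ) (r ∷ rs) = All-resp-⊆ τ r ∷ AllPairs-resp-⊆ τ rs

  partition-∪ : ∀ {P Q : Pred X 0ℓ} {xs} → All (P ∪ Q) xs →
    ∃₂ λ ys zs → (ys ⊆ xs × All P ys) × (zs ⊆ xs × All Q zs) × length ys + length zs ≡ length xs
  partition-∪ [] = [] , [] , ([] , []) , ([] , []) , refl
  partition-∪ (inj₁ p ∷ pqs) =
    let ys , zs , (τ , ps) , (τ′ , qs) , eq = partition-∪ pqs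
    in _ ∷ ys , zs , (refl ∷ τ , p ∷ ps) , (_ ∷ʳ τ′ , qs) , cong suc eq
  partition-∪ (inj₂ q ∷ pqs) =
    let ys , zs , (τ , ps) , (τ′ , qs) , eq = partition-∪ pqs
    in ys , _ ∷ zs , (_ ∷ʳ τ , ps) , (refl ∷ τ′ , q ∷ qs) , trans (+-suc _ _) (cong suc eq)

  AtMost-∪ : ∀ {m n} {P Q : Pred X 0ℓ} → AtMost m P → AtMost n Q → AtMost (m + n) (P ∪ Q)
  AtMost-∪ {m} {n} atMostP atMostQ xs u pqs =
    let ys , zs , (τ , ps) , (τ′ , qs) , eq = partition-∪ pqs
    in begin
      length xs              ≡⟨ sym eq ⟩
      length ys + length zs  ≤⟨ +-mono-≤ (atMostP ys (AllPairs-resp-⊆ τ u) ps)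
                                         (atMostQ zs (AllPairs-resp-⊆ τ′ u) qs) ⟩
      m + n                  ∎
    where open ≤-Reasoning

Image : {X Y : Set} → (X → Y) → Pred X 0ℓ → Pred Y 0ℓ
Image f Q y = ∃[ x ] Q x × f x ≡ y

module _ {X Y : Set} (f : X → Y) {Q : Pred X 0ℓ} where

  preimages : ∀ {ys} → All (Image f Q) ys → ∃[ xs ] All Q xs × map f xs ≡ ys
  preimages [] = [] , [] , refl
  preimages ((x , q , refl) ∷ images) =
    let xs , qs , eq = preimages images in x ∷ xs , q ∷ qs , cong (f x ∷_) eq

  AtMost-Image : ∀ {n} → AtMost n Q → AtMost n (Image f Q)
  AtMost-Image atMost ys u images with preimages images
  ... | xs , qs , refl = subst (_≤ _) (sym (length-map f xs)) (atMost xs (map⁻ u) qs)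

module _ {A : Set} {a : A} where

  replicate-⊆-∷⁻ : ∀ {n ys} → replicate n a ⊆ a ∷ ys → replicate (pred n) a ⊆ ys
  replicate-⊆-∷⁻ {zero} _ = minimum _
  replicate-⊆-∷⁻ {suc n} τ = ∷⁻ τ

  replicate-⊆-∷ʳ⁻ : ∀ {n b ys} → a ≢ b → replicate n a ⊆ b ∷ ys → replicate n a ⊆ ys
  replicate-⊆-∷ʳ⁻ {zero} _ _ = minimum _
  replicate-⊆-∷ʳ⁻ {suc n} a≢b τ = ∷ʳ⁻ a≢b τ

module DelayedStarts {A : Set} (_≟_ : DecidableEquality A) (σ : A) (r-1 : ℕ) where

  r : ℕ
  r = suc r-1

  -- Under with σ ≟ x, count (x ∷ T) reduces to count T or suc (count T); writing k * r rather than
  -- r * k, so that suc k * r reduces to suc (r-1 + k * r), keeps the arithmetic below definitional.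
  count : List A → ℕ
  count S = length (filter (σ ≟_) S)

  replicate-⊆⇒≤count : ∀ {c S} → replicate c σ ⊆ S → c ≤ count S
  replicate-⊆⇒≤count {c} {S} τ = begin
    c                                       ≡⟨ sym (length-replicate c) ⟩
    length (replicate c σ)                  ≡⟨ cong length (sym (filter-all (σ ≟_) (replicate⁺ c refl))) ⟩
    length (filter (σ ≟_) (replicate c σ))  ≤⟨ length-mono-≤ (⊆-filter-Sublist (σ ≟_) (σ ≟_) σ≡-trans τ) ⟩
    count S                                 ∎
    where
      open ≤-Reasoning
      σ≡-trans : ∀ {x y} → x ≡ y → σ ≡ x → σ ≡ y
      σ≡-trans refl σ≡x = σ≡x

  record Block (S : List A) (p q : ℕ) : Set where
    constructor block
    field
      increasing : p < q
      isSigma    : charAt S p ≡ just σ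
      hasPower   : replicate r σ ⊆ segment S p q

  -- Chain S p e (p₁ ∷ … ∷ pₖ ∷ []): p = p₁ (p = e when k = 0) and every [pⱼ, pⱼ₊₁) is a block,
  -- where pₖ₊₁ = e.
  data Chain (S : List A) : ℕ → ℕ → ∀ {k} → Vec ℕ k → Set where
    []  : ∀ {e} → Chain S e e []
    _∷_ : ∀ {p q e k} {ps : Vec ℕ k} → Block S p q → Chain S q e ps → Chain S p e (p ∷ ps)

  Chain-shift : ∀ {x T p e k} {ps : Vec ℕ k} → Chain (x ∷ T) (2 + p) (suc e) ps →
                Image (vmap suc) (Chain T (suc p) e) ps
  Chain-shift [] = [] , [] , refl
  Chain-shift (block (s≤s (s≤s p<q)) isSigma hasPower ∷ chain) with Chain-shift chain
  ... | qs , chain′ , refl = _ ∷ qs , block (s≤s p<q) isSigma hasPower ∷ chain′ , refl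

  -- A σ-start whose first position is preceded by σ^c: c counts the σ's still owed to the previous
  -- block, and c = 0 gives the σ-starts themselves.
  IsDelayedStart : ∀ {k} → List A → ℕ → Vec ℕ k → Set
  IsDelayedStart S c ps = ∃[ p ] replicate c σ ⊆ segment S 1 p × Chain S p (suc (length S)) ps

  no-start-in-[] : ∀ {c k} → Empty (IsDelayedStart {suc k} [] c)
  no-start-in-[] _ (zero , _ , block _ () _ ∷ _)
  no-start-in-[] _ (suc _ , _ , block _ () _ ∷ _)

  uncons-σ : ∀ {T c k} {ps : Vec ℕ (suc k)} → IsDelayedStart (σ ∷ T) c ps →
             (c ≡ 0 × Image (λ qs → 1 ∷ vmap suc qs) (IsDelayedStart T r-1) ps)
             ⊎ Image (vmap suc) (IsDelayedStart T (pred c)) ps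
  uncons-σ (zero , _ , block _ () _ ∷ _)
  uncons-σ {c = zero} (1 , _ , block (s≤s (s≤s _)) _ hasPower ∷ chain) with Chain-shift chain
  ... | qs , chain′ , refl = inj₁ (refl , qs , (_ , ∷⁻ hasPower , chain′) , refl)
  uncons-σ {c = suc _} (1 , () , _)
  uncons-σ (suc (suc _) , prefix , chain) with Chain-shift chain
  ... | qs , chain′ , refl = inj₂ (qs , (_ , replicate-⊆-∷⁻ prefix , chain′) , refl)

  uncons-≢ : ∀ {x T c k} {ps : Vec ℕ (suc k)} → σ ≢ x → IsDelayedStart (x ∷ T) c ps →
             Image (vmap suc) (IsDelayedStart T c) ps
  uncons-≢ _ (zero , _ , block _ () _ ∷ _)
  uncons-≢ σ≢x (1 , _ , block _ refl _ ∷ _) = contradiction refl σ≢x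
  uncons-≢ σ≢x (suc (suc _) , prefix , chain) with Chain-shift chain
  ... | qs , chain′ , refl = qs , (_ , replicate-⊆-∷ʳ⁻ σ≢x prefix , chain′) , refl

  IsDelayedStart⇒≤count : ∀ S {c k} {ps : Vec ℕ k} → IsDelayedStart S c ps → c + k * r ≤ count S
  IsDelayedStart⇒≤count S {c} {ps = []} (_ , prefix , []) =
    subst (_≤ count S) (sym (+-identityʳ c))
      (replicate-⊆⇒≤count (subst (replicate c σ ⊆_) (take-all (length S) S ≤-refl) prefix))
  IsDelayedStart⇒≤count [] {k = suc _} start = contradiction start (no-start-in-[] _)
  IsDelayedStart⇒≤count (x ∷ T) {c} {suc _} start with σ ≟ x
  ... | no σ≢x = let _ , start′ , _ = uncons-≢ σ≢x start in IsDelayedStart⇒≤count T start′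
  ... | yes refl with uncons-σ start
  ...   | inj₁ (refl , _ , start′ , refl) = s≤s (IsDelayedStart⇒≤count T start′)
  ...   | inj₂ (_ , start′ , refl) = pred[c]+m≤n⇒c+m≤1+n c (IsDelayedStart⇒≤count T start′)
    where
      pred[c]+m≤n⇒c+m≤1+n : ∀ c {m n} → pred c + m ≤ n → c + m ≤ suc n
      pred[c]+m≤n⇒c+m≤1+n zero = m≤n⇒m≤1+n
      pred[c]+m≤n⇒c+m≤1+n (suc c) = s≤s

  delayedStarts-atMost : ∀ S k c R → count S ≤ c + k * r + R →
                         AtMost ((R + k) C k) (IsDelayedStart {k} S c)
  delayedStarts-atMost S zero c R _ = AtMost-irrelevant λ { [] [] → refl }
  delayedStarts-atMost [] (suc k) c R _ = AtMost-empty no-start-in-[]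
  delayedStarts-atMost (x ∷ T) (suc k) c R count≤ with σ ≟ x
  ... | no σ≢x =
    AtMost-⊆ (uncons-≢ σ≢x) (AtMost-Image (vmap suc) (delayedStarts-atMost T (suc k) c R count≤))
  delayedStarts-atMost (x ∷ T) (suc k) (suc c) R count≤ | yes refl =
    AtMost-⊆ uncons-σ
      (AtMost-∪ (AtMost-empty λ { _ (() , _) })
                (AtMost-Image (vmap suc) (delayedStarts-atMost T (suc k) c R (s≤s⁻¹ count≤))))
  delayedStarts-atMost (x ∷ T) (suc k) zero R count≤ | yes refl =
    AtMost-mono (≤-reflexive pascal) (AtMost-⊆ uncons-σ (AtMost-∪ startsAt1 (startsLater R count≤)))
    where
      pascal : (R + k) C k + (R + k) C suc k ≡ (R + suc k) C suc k
      pascal = trans (nCk+nC[k+1]≡[n+1]C[k+1] (R + k) k) (cong (_C suc k) (sym (+-suc R k)))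

      startsAt1 : AtMost ((R + k) C k)
                         (λ ps → 0 ≡ 0 × Image (λ qs → 1 ∷ vmap suc qs) (IsDelayedStart T r-1) ps)
      startsAt1 = AtMost-⊆ proj₂ (AtMost-Image _ (delayedStarts-atMost T k r-1 R (s≤s⁻¹ count≤)))

      startsLater : ∀ R → count T < suc k * r + R →
                    AtMost ((R + k) C suc k) (Image (vmap suc) (IsDelayedStart T 0))
      startsLater zero count< = AtMost-empty λ { _ (_ , start , _) →
        ≤⇒≯ (IsDelayedStart⇒≤count T start) (subst (count T <_) (+-identityʳ _) count<) }
      startsLater (suc R) count< =
        AtMost-mono (≤-reflexive (cong (_C suc k) (+-suc R k)))
          (AtMost-Image _ (delayedStarts-atMost T (suc k) 0 R
                             (s≤s⁻¹ (subst (count T <_) (+-suc _ R) count<))))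

  IsSigmaStart-head : ∀ {S k p ps} → IsSigmaStart S σ (suc k) r (p ∷ ps) →
                      Block S p (lookup (extend S ps) fzero)
  IsSigmaStart-head start = block (increasing fzero) (isSigma fzero) (hasPower fzero)
    where open IsSigmaStart start

  IsSigmaStart-tail : ∀ {S k p ps} → IsSigmaStart S σ (suc k) r (p ∷ ps) → IsSigmaStart S σ k r ps
  IsSigmaStart-tail start = record
    { positive   = positive ∘ fsuc
    ; increasing = increasing ∘ fsuc
    ; isSigma    = isSigma ∘ fsuc
    ; hasPower   = hasPower ∘ fsuc
    }
    where open IsSigmaStart start

  IsSigmaStart⇒Chain : ∀ {S k} {ps : Vec ℕ k} → IsSigmaStart S σ k r ps →
                       Chain S (lookup (extend S ps) fzero) (suc (length S)) ps
  IsSigmaStart⇒Chain {ps = []} _ = []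
  IsSigmaStart⇒Chain {ps = _ ∷ _} start =
    IsSigmaStart-head start ∷ IsSigmaStart⇒Chain (IsSigmaStart-tail start)

-- The bound also holds for k = 0.
lemma7 : {A : Set} (_≟_ : DecidableEquality A) (S : List A) (σ : A) (k r : ℕ) →
         1 ≤ k → 1 ≤ r →
         r * k ≤ length (filter (σ ≟_) S) →
         (starts : List (Vec ℕ k)) → Unique starts → All (IsSigmaStart S σ k r) starts →
         length starts ≤ ((length (filter (σ ≟_) S) ∸ r * k) + k) C k
lemma7 _≟_ S σ k (suc r-1) _ _ rk≤ℓ starts unique areStarts =
  delayedStarts-atMost S k 0 (ℓ ∸ r * k) ℓ≤kr+[ℓ∸rk] starts unique
    (All.map (λ start → _ , minimum _ , IsSigmaStart⇒Chain start) areStarts)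
  where
    open DelayedStarts _≟_ σ r-1

    ℓ : ℕ
    ℓ = count S

    ℓ≤kr+[ℓ∸rk] : ℓ ≤ 0 + k * r + (ℓ ∸ r * k)
    ℓ≤kr+[ℓ∸rk] = ≤-reflexive (sym (trans (cong (_+ (ℓ ∸ r * k)) (*-comm k r)) (m+[n∸m]≡n rk≤ℓ)))
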